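{- Let $G=K_n$ and let $J$ be the matching with edge set $\{(i,i') : 1\le i\le n\}$. Then for every $k\ge 1$ the vertex expansion coefficient of $G^k$ is greater than $\frac{1}{2k}$.
   Context: Let $G=K_n$ with vertex set $\{v_1,\dots,v_n\}$, and $K_{n,n}$ the complete bipartite graph with parts $\{1,\dots,n\}$ and $\{1',\dots,n'\}$. The self-similar graphs based on $(G,J)$: $G^1=G$; for $k\ge2$, $V(G^k)=V(G)^k$, and $(v_{i_1},\dots,v_{i_k})\sim(v_{j_1},\dots,v_{j_k})$ in $G^k$ iff either (1) $(v_{i_1},\dots,v_{i_{k-1}})=(v_{j_1},\dots,v_{j_{k-1}})$ and $v_{i_k}\sim v_{j_k}$ in $G$, or (2) $(v_{i_1},\dots,v_{i_{k-1}})\sim(v_{j_1},\dots,v_{j_{k-1}})$ in $G^{k-1}$ and $i_k\sim j_k'$ in $J$. (With this $J$, $G^k$ is regular.) For a regular graph $H$, the vertex expansion coefficient is the minimum of $\frac{\partial_H(S)}{|S|}$ over all non-empty $S\subseteq V(H)$ with $|S|\le |V(H)|/2$, where $\partial_H(S)$ is the number of vertices in $V(H)\setminus S$ adjacent to at least one vertex of $S$. -}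

module Defs where

open import Data.Nat using (ℕ; zero; suc)
open import Data.Bool using (Bool; true; false; _∧_; _∨_; not)
open import Data.Fin using (Fin)
open import Data.Fin.Properties renaming (_≟_ to _≟ᶠ_)
open import Data.Vec using (Vec; []; _∷_)
open import Data.Vec.Properties using (≡-dec)
open import Data.List using (List; []; _∷_; map; concatMap)
open import Data.Bool.ListAction using (any)
open import Data.List.Base using (allFin)
open import Relation.Nullary.Decidable using (⌊_⌋; ¬?)

-- A vertex (v_{i_1}, …, v_{i_k}) of G^k is represented as the vector
-- i_k ∷ i_{k-1} ∷ … ∷ i_1 ∷ []  (LAST coordinate at the head), so that
-- the prefix (i_1,…,i_{k-1}) is the tail of the vector.
Vertex : ℕ → ℕ → Set
Vertex n k = Vec (Fin n) k

_==ᶠ_ : {n : ℕ} → Fin n → Fin n → Bool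
i ==ᶠ j = ⌊ i ≟ᶠ j ⌋

_==ᵛ_ : {n k : ℕ} → Vec (Fin n) k → Vec (Fin n) k → Bool
u ==ᵛ w = ⌊ ≡-dec _≟ᶠ_ u w ⌋

adjK : {n : ℕ} → Fin n → Fin n → Bool
adjK i j = not (i ==ᶠ j)

-- adjacency in J = {(i,i')}: i ~ j' iff i = j
adjJ : {n : ℕ} → Fin n → Fin n → Bool
adjJ i j = i ==ᶠ j

-- adjacency in G^k.  G^0 is the single-vertex graph with no edges; then
-- the recursive clause yields exactly G^1 = G and the paper's rule for k ≥ 2.
Adj : {n : ℕ} (k : ℕ) → Vertex n k → Vertex n k → Bool
Adj zero [] [] = false
Adj (suc k) (i ∷ u) (j ∷ w) = ((u ==ᵛ w) ∧ adjK i j) ∨ (Adj k u w ∧ adjJ i j)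

allVertices : (n k : ℕ) → List (Vertex n k)
allVertices n zero = [] ∷ []
allVertices n (suc k) = concatMap (λ i → map (i ∷_) (allVertices n k)) (allFin n)

count : {A : Set} → (A → Bool) → List A → ℕ
count p [] = 0
count p (x ∷ xs) with p x
... | true = suc (count p xs)
... | false = count p xs

Subset : ℕ → ℕ → Set
Subset n k = Vertex n k → Bool

card : (n k : ℕ) → Subset n k → ℕ
card n k S = count S (allVertices n k)

boundary : (n k : ℕ) → Subset n k → ℕ
boundary n k S =
  count (λ v → not (S v) ∧ any (λ u → S u ∧ Adj k u v) (allVertices n k))
        (allVertices n k)

-- The graph G^k is the Hamming graph: (i ∷ u) ~ (j ∷ w) iff either u = w and i ≠ j, or
-- u ~ w and i = j, so it is k(n-1)-regular.  Let cut S count the ordered edges leaving S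
-- and pairs S = |S| |Sᶜ|.  Routing a pair (i ∷ u, j ∷ w) through j ∷ u and inducting on k
-- gives the Poincaré-type inequality n |S| |Sᶜ| ≤ n^k cut S.  Each vertex of ∂S absorbs at
-- most k(n-1) cut edges, so |Sᶜ| ≥ n^k / 2 gives n |S| ≤ 2k(n-1) |∂S|, whence |S| < 2k |∂S|.
module Submission where

open import Defs
open import Data.Bool using (Bool; true; false; _∧_; _∨_; not)
open import Data.Fin using (Fin; zero; suc)
open import Data.Fin.Properties using () renaming (_≟_ to _≟ᶠ_)
open import Data.List using (List; []; _∷_; _++_; map; concatMap; allFin; length)
open import Data.List.Properties using (map-tabulate; length-tabulate)
open import Data.Bool.ListAction using (any)
open import Data.Nat using (ℕ; zero; suc; pred; _+_; _*_; _^_; _≤_; _<_; z≤n; s≤s; NonZero; >-nonZero)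
open import Data.Nat.Properties
open import Data.Nat.Tactic.RingSolver using (solve-∀)
open import Data.Vec using ([]; _∷_)
open import Data.Vec.Properties using (≡-dec)
open import Function using (_∘_; id; mk⇔)
open import Relation.Binary.Definitions using (DecidableEquality)
open import Relation.Binary.PropositionalEquality
open import Relation.Nullary using (yes; no)
open import Relation.Nullary.Decidable using (⌊_⌋; isYes≗does; does-⇔; ⌊⌋-map′)

χ : Bool → ℕ
χ true = 1
χ false = 0

∑ : {A : Set} → List A → (A → ℕ) → ℕ
∑ [] f = 0
∑ (x ∷ xs) f = f x + ∑ xs f

infix 5 ∑
syntax ∑ xs (λ x → e) = ∑[ x ∈ xs ] e

module _ {A : Set} where

  ∑-cong : (xs : List A) {f g : A → ℕ} → (∀ x → f x ≡ g x) → ∑ xs f ≡ ∑ xs g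
  ∑-cong [] f≗g = refl
  ∑-cong (x ∷ xs) f≗g = cong₂ _+_ (f≗g x) (∑-cong xs f≗g)

  ∑-mono-≤ : (xs : List A) {f g : A → ℕ} → (∀ x → f x ≤ g x) → ∑ xs f ≤ ∑ xs g
  ∑-mono-≤ [] f≤g = z≤n
  ∑-mono-≤ (x ∷ xs) f≤g = +-mono-≤ (f≤g x) (∑-mono-≤ xs f≤g)

  ∑-distrib-+ : (xs : List A) (f g : A → ℕ) → ∑[ x ∈ xs ] (f x + g x) ≡ ∑ xs f + ∑ xs g
  ∑-distrib-+ [] f g = refl
  ∑-distrib-+ (x ∷ xs) f g = begin
    f x + g x + (∑[ x ∈ xs ] f x + g x) ≡⟨ cong (f x + g x +_) (∑-distrib-+ xs f g) ⟩
    f x + g x + (∑ xs f + ∑ xs g)       ≡⟨ +-+-comm (f x) (g x) (∑ xs f) (∑ xs g) ⟩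
    f x + ∑ xs f + (g x + ∑ xs g)       ∎
    where open ≡-Reasoning
          +-+-comm : ∀ a b c d → a + b + (c + d) ≡ a + c + (b + d)
          +-+-comm = solve-∀

  ∑-*ˡ : (xs : List A) (c : ℕ) (f : A → ℕ) → ∑[ x ∈ xs ] c * f x ≡ c * ∑ xs f
  ∑-*ˡ [] c f = sym (*-zeroʳ c)
  ∑-*ˡ (x ∷ xs) c f = trans (cong (c * f x +_) (∑-*ˡ xs c f)) (sym (*-distribˡ-+ c (f x) (∑ xs f)))

  ∑-zero : (xs : List A) → ∑[ x ∈ xs ] 0 ≡ 0
  ∑-zero [] = refl
  ∑-zero (x ∷ xs) = ∑-zero xs

  ∑-const : (xs : List A) (c : ℕ) → ∑[ x ∈ xs ] c ≡ length xs * c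
  ∑-const [] c = refl
  ∑-const (x ∷ xs) c = cong (c +_) (∑-const xs c)

  ∑-++ : (xs ys : List A) (f : A → ℕ) → ∑ (xs ++ ys) f ≡ ∑ xs f + ∑ ys f
  ∑-++ [] ys f = refl
  ∑-++ (x ∷ xs) ys f = trans (cong (f x +_) (∑-++ xs ys f)) (sym (+-assoc (f x) (∑ xs f) (∑ ys f)))

module _ {A B : Set} where

  ∑-map : (h : A → B) (xs : List A) (f : B → ℕ) → ∑ (map h xs) f ≡ ∑[ x ∈ xs ] f (h x)
  ∑-map h [] f = refl
  ∑-map h (x ∷ xs) f = cong (f (h x) +_) (∑-map h xs f)

  ∑-concatMap : (g : A → List B) (xs : List A) (f : B → ℕ) →
    ∑ (concatMap g xs) f ≡ ∑[ x ∈ xs ] ∑ (g x) f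
  ∑-concatMap g [] f = refl
  ∑-concatMap g (x ∷ xs) f =
    trans (∑-++ (g x) (concatMap g xs) f) (cong (∑ (g x) f +_) (∑-concatMap g xs f))

  ∑-comm : (xs : List A) (ys : List B) (f : A → B → ℕ) →
    ∑[ x ∈ xs ] ∑[ y ∈ ys ] f x y ≡ ∑[ y ∈ ys ] ∑[ x ∈ xs ] f x y
  ∑-comm [] ys f = sym (∑-zero ys)
  ∑-comm (x ∷ xs) ys f =
    trans (cong (∑ ys (f x) +_) (∑-comm xs ys f)) (sym (∑-distrib-+ ys (f x) _))

  ∑∑-distrib-+ : (xs : List A) (ys : List B) (f g : A → B → ℕ) →
    ∑[ x ∈ xs ] ∑[ y ∈ ys ] (f x y + g x y) ≡
    (∑[ x ∈ xs ] ∑[ y ∈ ys ] f x y) + (∑[ x ∈ xs ] ∑[ y ∈ ys ] g x y)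
  ∑∑-distrib-+ xs ys f g =
    trans (∑-cong xs (λ x → ∑-distrib-+ ys (f x) (g x))) (∑-distrib-+ xs (λ x → ∑ ys (f x)) _)

  ∑-*-∑ : (xs : List A) (ys : List B) (f : A → ℕ) (g : B → ℕ) →
    ∑ xs f * ∑ ys g ≡ ∑[ x ∈ xs ] ∑[ y ∈ ys ] f x * g y
  ∑-*-∑ xs ys f g = begin
    ∑ xs f * ∑ ys g              ≡⟨ *-comm (∑ xs f) (∑ ys g) ⟩
    ∑ ys g * ∑ xs f              ≡⟨ ∑-*ˡ xs (∑ ys g) f ⟨
    ∑[ x ∈ xs ] ∑ ys g * f x     ≡⟨ ∑-cong xs (λ x → *-comm (∑ ys g) (f x)) ⟩
    ∑[ x ∈ xs ] f x * ∑ ys g     ≡⟨ ∑-cong xs (λ x → ∑-*ˡ ys (f x) g) ⟨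
    ∑[ x ∈ xs ] ∑[ y ∈ ys ] f x * g y ∎
    where open ≡-Reasoning

count≡∑χ : {A : Set} (p : A → Bool) (xs : List A) → count p xs ≡ ∑[ x ∈ xs ] χ (p x)
count≡∑χ p [] = refl
count≡∑χ p (x ∷ xs) with p x
... | true = cong suc (count≡∑χ p xs)
... | false = count≡∑χ p xs

∑χ≡0 : {A : Set} (p : A → Bool) (xs : List A) → any p xs ≡ false → ∑[ x ∈ xs ] χ (p x) ≡ 0
∑χ≡0 p [] _ = refl
∑χ≡0 p (x ∷ xs) none with p x
... | false = ∑χ≡0 p xs none

∑χ≤*χ-any : {A : Set} (p : A → Bool) (xs : List A) {d : ℕ} →
  ∑[ x ∈ xs ] χ (p x) ≤ d → ∑[ x ∈ xs ] χ (p x) ≤ d * χ (any p xs)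
∑χ≤*χ-any p xs {d} ∑≤d with any p xs in eq
... | true = subst (_ ≤_) (sym (*-identityʳ d)) ∑≤d
... | false = ≤-reflexive (trans (∑χ≡0 p xs eq) (sym (*-zeroʳ d)))

χ-∧ : ∀ a b → χ (a ∧ b) ≡ χ a * χ b
χ-∧ true b = sym (+-identityʳ (χ b))
χ-∧ false b = refl

χ-∧-≤ʳ : ∀ a b → χ (a ∧ b) ≤ χ b
χ-∧-≤ʳ true b = ≤-refl
χ-∧-≤ʳ false b = z≤n

χ+χ-not : ∀ a → χ a + χ (not a) ≡ 1
χ+χ-not true = refl
χ+χ-not false = refl

χ*χ-not : ∀ a → χ a * χ (not a) ≡ 0
χ*χ-not true = refl
χ*χ-not false = refl

χ-not-triangle : ∀ a b c → χ a * χ (not c) ≤ χ a * χ (not b) + χ b * χ (not c)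
χ-not-triangle false b c = z≤n
χ-not-triangle true b true = z≤n
χ-not-triangle true true false = s≤s z≤n
χ-not-triangle true false false = s≤s z≤n

χ-if : ∀ a b c → χ ((a ∧ not b) ∨ (c ∧ b)) ≡ χ a * χ (not b) + χ b * χ c
χ-if true true true = refl
χ-if true true false = refl
χ-if true false true = refl
χ-if true false false = refl
χ-if false true true = refl
χ-if false true false = refl
χ-if false false true = refl
χ-if false false false = refl

module _ {A : Set} (_≟_ : DecidableEquality A) where

  ⌊≟⌋-sym : (x y : A) → ⌊ x ≟ y ⌋ ≡ ⌊ y ≟ x ⌋
  ⌊≟⌋-sym x y = begin
    ⌊ x ≟ y ⌋   ≡⟨ isYes≗does (x ≟ y) ⟩
    _           ≡⟨ does-⇔ (mk⇔ sym sym) (x ≟ y) (y ≟ x) ⟩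
    _           ≡⟨ isYes≗does (y ≟ x) ⟨
    ⌊ y ≟ x ⌋   ∎
    where open ≡-Reasoning

  χ-not-⌊≟⌋-redundant : (f : A → Bool) (x y : A) →
    χ (f x) * χ (not (f y)) * χ (not ⌊ x ≟ y ⌋) ≡ χ (f x) * χ (not (f y))
  χ-not-⌊≟⌋-redundant f x y with x ≟ y
  ... | yes refl = trans (*-zeroʳ (χ (f x) * χ (not (f x)))) (sym (χ*χ-not (f x)))
  ... | no _ = *-identityʳ _

pairs : {A : Set} → List A → (A → Bool) → ℕ
pairs xs S = ∑[ x ∈ xs ] ∑[ y ∈ xs ] χ (S x) * χ (not (S y))

module _ {A : Set} (xs : List A) (adj : A → A → Bool) where

  cut : (A → Bool) → ℕ
  cut S = ∑[ x ∈ xs ] ∑[ y ∈ xs ] χ (S x) * χ (not (S y)) * χ (adj x y)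

  inDegree : A → ℕ
  inDegree y = ∑[ x ∈ xs ] χ (adj x y)

  cut≤*boundary : (S : A → Bool) (d : ℕ) → (∀ y → inDegree y ≤ d) →
    cut S ≤ d * count (λ y → not (S y) ∧ any (λ x → S x ∧ adj x y) xs) xs
  cut≤*boundary S d deg≤d = begin
    cut S
      ≡⟨ ∑-comm xs xs (λ x y → χ (S x) * χ (not (S y)) * χ (adj x y)) ⟩
    ∑[ y ∈ xs ] ∑[ x ∈ xs ] χ (S x) * χ (not (S y)) * χ (adj x y)
      ≤⟨ ∑-mono-≤ xs cut-at ⟩
    ∑[ y ∈ xs ] d * χ (isBoundary y)
      ≡⟨ ∑-*ˡ xs d (χ ∘ isBoundary) ⟩
    d * (∑[ y ∈ xs ] χ (isBoundary y))
      ≡⟨ cong (d *_) (count≡∑χ isBoundary xs) ⟨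
    d * count isBoundary xs ∎
    where
    open ≤-Reasoning
    neighbourOfS : A → A → Bool
    neighbourOfS y x = S x ∧ adj x y
    isBoundary : A → Bool
    isBoundary y = not (S y) ∧ any (neighbourOfS y) xs
    cut-at : ∀ y → ∑[ x ∈ xs ] χ (S x) * χ (not (S y)) * χ (adj x y) ≤ d * χ (isBoundary y)
    cut-at y = begin
      ∑[ x ∈ xs ] χ (S x) * χ (not (S y)) * χ (adj x y)
        ≡⟨ ∑-cong xs (λ x → trans (rearrange (χ (S x)) _ _) (cong (χ (not (S y)) *_) (sym (χ-∧ (S x) (adj x y))))) ⟩
      ∑[ x ∈ xs ] χ (not (S y)) * χ (neighbourOfS y x)
        ≡⟨ ∑-*ˡ xs (χ (not (S y))) (χ ∘ neighbourOfS y) ⟩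
      χ (not (S y)) * (∑[ x ∈ xs ] χ (neighbourOfS y x))
        ≤⟨ *-monoʳ-≤ (χ (not (S y))) (∑χ≤*χ-any (neighbourOfS y) xs
             (≤-trans (∑-mono-≤ xs (λ x → χ-∧-≤ʳ (S x) (adj x y))) (deg≤d y))) ⟩
      χ (not (S y)) * (d * χ (any (neighbourOfS y) xs))
        ≡⟨ rearrange′ (χ (not (S y))) d _ ⟩
      d * (χ (not (S y)) * χ (any (neighbourOfS y) xs))
        ≡⟨ cong (d *_) (χ-∧ (not (S y)) _) ⟨
      d * χ (isBoundary y) ∎
      where
      rearrange : ∀ a b c → a * b * c ≡ b * (a * c)
      rearrange = solve-∀
      rearrange′ : ∀ a b c → a * (b * c) ≡ b * (a * c)
      rearrange′ = solve-∀

expansion-bound : ∀ {m k c t N E B} → 0 < c → c + t ≡ N → 2 * c ≤ N →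
  suc m * (c * t) ≤ N * E → E ≤ k * m * B → c < 2 * k * B
expansion-bound {m} {k} {c} {t} {N} {E} {B} c>0 c+t≡N 2c≤N pairs≤ E≤ =
  ≰⇒> λ 2kB≤c → <⇒≱ (m<n+m (m * c) c>0) (≤-trans suc-m*c≤ (*-monoʳ-≤ m 2kB≤c))
  where
  open ≤-Reasoning
  c≤t : c ≤ t
  c≤t = +-cancelˡ-≤ c c t (subst₂ _≤_ (cong (c +_) (+-identityʳ c)) (sym c+t≡N) 2c≤N)
  N≤2t : N ≤ 2 * t
  N≤2t = subst₂ _≤_ c+t≡N (cong (t +_) (sym (+-identityʳ t))) (+-monoˡ-≤ t c≤t)
  instance
    N≢0 : NonZero N
    N≢0 = >-nonZero (≤-trans (≤-trans c>0 (m≤m+n c t)) (≤-reflexive c+t≡N))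
  suc-m*c≤ : suc m * c ≤ m * (2 * k * B)
  suc-m*c≤ = *-cancelˡ-≤ N (begin
    N * (suc m * c)            ≤⟨ *-monoˡ-≤ (suc m * c) N≤2t ⟩
    2 * t * (suc m * c)        ≡⟨ regroup t (suc m) c ⟩
    2 * (suc m * (c * t))      ≤⟨ *-monoʳ-≤ 2 pairs≤ ⟩
    2 * (N * E)                ≤⟨ *-monoʳ-≤ 2 (*-monoʳ-≤ N E≤) ⟩
    2 * (N * (k * m * B))      ≡⟨ regroup′ N k m B ⟩
    N * (m * (2 * k * B))      ∎)
    where
    regroup : ∀ t a c → 2 * t * (a * c) ≡ 2 * (a * (c * t))
    regroup = solve-∀
    regroup′ : ∀ N k m B → 2 * (N * (k * m * B)) ≡ N * (m * (2 * k * B))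
    regroup′ = solve-∀

∑-allFin-suc : (n : ℕ) (f : Fin (suc n) → ℕ) →
  ∑[ i ∈ allFin (suc n) ] f i ≡ f zero + (∑[ i ∈ allFin n ] f (suc i))
∑-allFin-suc n f =
  cong (f zero +_) (trans (cong (λ is → ∑ is f) (sym (map-tabulate id suc))) (∑-map suc (allFin n) f))

∑-allFin-const : (n c : ℕ) → ∑[ i ∈ allFin n ] c ≡ n * c
∑-allFin-const n c = trans (∑-const (allFin n) c) (cong (_* c) (length-tabulate {n = n} id))

==ᶠ-suc : {n : ℕ} (i j : Fin n) → (suc i ==ᶠ suc j) ≡ (i ==ᶠ j)
==ᶠ-suc i j = ⌊⌋-map′ _ _ (i ≟ᶠ j)

∑-δᶠ : {n : ℕ} (j : Fin n) (g : Fin n → ℕ) → ∑[ i ∈ allFin n ] χ (i ==ᶠ j) * g i ≡ g j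
∑-δᶠ {suc n} zero g = begin
  ∑[ i ∈ allFin (suc n) ] χ (i ==ᶠ zero) * g i ≡⟨ ∑-allFin-suc n (λ i → χ (i ==ᶠ zero) * g i) ⟩
  g zero + 0 + (∑[ i ∈ allFin n ] 0)          ≡⟨ cong (g zero + 0 +_) (∑-zero (allFin n)) ⟩
  g zero + 0 + 0                              ≡⟨ trans (+-identityʳ _) (+-identityʳ _) ⟩
  g zero                                      ∎
  where open ≡-Reasoning
∑-δᶠ {suc n} (suc j) g = begin
  ∑[ i ∈ allFin (suc n) ] χ (i ==ᶠ suc j) * g i ≡⟨ ∑-allFin-suc n (λ i → χ (i ==ᶠ suc j) * g i) ⟩
  ∑[ i ∈ allFin n ] χ (suc i ==ᶠ suc j) * g (suc i)
    ≡⟨ ∑-cong (allFin n) (λ i → cong (λ b → χ b * g (suc i)) (==ᶠ-suc i j)) ⟩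
  ∑[ i ∈ allFin n ] χ (i ==ᶠ j) * g (suc i)     ≡⟨ ∑-δᶠ j (g ∘ suc) ⟩
  g (suc j)                                     ∎
  where open ≡-Reasoning

∑-δᶠ′ : {n : ℕ} (i : Fin n) (g : Fin n → ℕ) → ∑[ j ∈ allFin n ] χ (i ==ᶠ j) * g j ≡ g i
∑-δᶠ′ {n} i g =
  trans (∑-cong (allFin n) (λ j → cong (λ b → χ b * g j) (⌊≟⌋-sym _≟ᶠ_ i j))) (∑-δᶠ i g)

∑-χ-≢ : {n : ℕ} (j : Fin n) → ∑[ i ∈ allFin n ] χ (not (i ==ᶠ j)) ≡ pred n
∑-χ-≢ {n} j = cong pred (begin
  1 + (∑[ i ∈ allFin n ] χ (not (i ==ᶠ j)))
    ≡⟨ cong (_+ (∑[ i ∈ allFin n ] χ (not (i ==ᶠ j)))) ∑-χ-≡ ⟨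
  (∑[ i ∈ allFin n ] χ (i ==ᶠ j)) + (∑[ i ∈ allFin n ] χ (not (i ==ᶠ j)))
    ≡⟨ ∑-distrib-+ (allFin n) _ _ ⟨
  ∑[ i ∈ allFin n ] (χ (i ==ᶠ j) + χ (not (i ==ᶠ j)))
    ≡⟨ ∑-cong (allFin n) (λ i → χ+χ-not (i ==ᶠ j)) ⟩
  ∑[ i ∈ allFin n ] 1
    ≡⟨ trans (∑-allFin-const n 1) (*-identityʳ n) ⟩
  n ∎)
  where
  open ≡-Reasoning
  ∑-χ-≡ : ∑[ i ∈ allFin n ] χ (i ==ᶠ j) ≡ 1
  ∑-χ-≡ = trans (∑-cong (allFin n) (λ i → sym (*-identityʳ (χ (i ==ᶠ j))))) (∑-δᶠ j (λ _ → 1))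

==ᵛ-∷ : {n k : ℕ} (i j : Fin n) (u w : Vertex n k) → ((i ∷ u) ==ᵛ (j ∷ w)) ≡ (i ==ᶠ j) ∧ (u ==ᵛ w)
==ᵛ-∷ i j u w = begin
  ⌊ ≡-dec _≟ᶠ_ (i ∷ u) (j ∷ w) ⌋ ≡⟨ isYes≗does (≡-dec _≟ᶠ_ (i ∷ u) (j ∷ w)) ⟩
  _                             ≡⟨ cong₂ _∧_ (isYes≗does (i ≟ᶠ j)) (isYes≗does (≡-dec _≟ᶠ_ u w)) ⟨
  (i ==ᶠ j) ∧ (u ==ᵛ w)         ∎
  where open ≡-Reasoning

χ-Adj-∷ : {n k : ℕ} (i j : Fin n) (u w : Vertex n k) →
  χ (Adj (suc k) (i ∷ u) (j ∷ w)) ≡ χ (u ==ᵛ w) * χ (not (i ==ᶠ j)) + χ (i ==ᶠ j) * χ (Adj k u w)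
χ-Adj-∷ {k = k} i j u w = χ-if (u ==ᵛ w) (i ==ᶠ j) (Adj k u w)

module Hamming (n : ℕ) where

  vertices : (k : ℕ) → List (Vertex n k)
  vertices = allVertices n

  fibre : {k : ℕ} → Subset n (suc k) → Fin n → Subset n k
  fibre S i u = S (i ∷ u)

  cutₖ : (k : ℕ) → Subset n k → ℕ
  cutₖ k = cut (vertices k) (Adj k)

  ∑-vertices-suc : (k : ℕ) (f : Vertex n (suc k) → ℕ) →
    ∑[ x ∈ vertices (suc k) ] f x ≡ ∑[ i ∈ allFin n ] ∑[ u ∈ vertices k ] f (i ∷ u)
  ∑-vertices-suc k f =
    trans (∑-concatMap (λ i → map (i ∷_) (vertices k)) (allFin n) f)
          (∑-cong (allFin n) (λ i → ∑-map (i ∷_) (vertices k) f))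

  ∑∑-vertices-suc : (k : ℕ) (F : Vertex n (suc k) → Vertex n (suc k) → ℕ) →
    ∑[ x ∈ vertices (suc k) ] ∑[ y ∈ vertices (suc k) ] F x y ≡
    ∑[ i ∈ allFin n ] ∑[ j ∈ allFin n ] ∑[ u ∈ vertices k ] ∑[ w ∈ vertices k ] F (i ∷ u) (j ∷ w)
  ∑∑-vertices-suc k F = begin
    ∑[ x ∈ vertices (suc k) ] ∑[ y ∈ vertices (suc k) ] F x y
      ≡⟨ ∑-vertices-suc k (λ x → ∑[ y ∈ vertices (suc k) ] F x y) ⟩
    ∑[ i ∈ allFin n ] ∑[ u ∈ vertices k ] ∑[ y ∈ vertices (suc k) ] F (i ∷ u) y
      ≡⟨ ∑-cong (allFin n) (λ i → ∑-cong (vertices k) (λ u → ∑-vertices-suc k (F (i ∷ u)))) ⟩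
    ∑[ i ∈ allFin n ] ∑[ u ∈ vertices k ] ∑[ j ∈ allFin n ] ∑[ w ∈ vertices k ] F (i ∷ u) (j ∷ w)
      ≡⟨ ∑-cong (allFin n) (λ i → ∑-comm (vertices k) (allFin n) _) ⟩
    ∑[ i ∈ allFin n ] ∑[ j ∈ allFin n ] ∑[ u ∈ vertices k ] ∑[ w ∈ vertices k ] F (i ∷ u) (j ∷ w) ∎
    where open ≡-Reasoning

  ∑-vertices-const : (k c : ℕ) → ∑[ x ∈ vertices k ] c ≡ n ^ k * c
  ∑-vertices-const zero c = refl
  ∑-vertices-const (suc k) c = begin
    ∑[ x ∈ vertices (suc k) ] c               ≡⟨ ∑-vertices-suc k (λ _ → c) ⟩
    ∑[ i ∈ allFin n ] ∑[ u ∈ vertices k ] c   ≡⟨ ∑-cong (allFin n) (λ _ → ∑-vertices-const k c) ⟩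
    ∑[ i ∈ allFin n ] n ^ k * c               ≡⟨ ∑-allFin-const n (n ^ k * c) ⟩
    n * (n ^ k * c)                           ≡⟨ *-assoc n (n ^ k) c ⟨
    n ^ suc k * c                             ∎
    where open ≡-Reasoning

  ∑-δᵛ : (k : ℕ) (w : Vertex n k) (g : Vertex n k → ℕ) →
    ∑[ u ∈ vertices k ] χ (u ==ᵛ w) * g u ≡ g w
  ∑-δᵛ zero [] g = trans (+-identityʳ _) (+-identityʳ (g []))
  ∑-δᵛ (suc k) (j ∷ w) g = begin
    ∑[ x ∈ vertices (suc k) ] χ (x ==ᵛ (j ∷ w)) * g x
      ≡⟨ ∑-vertices-suc k (λ x → χ (x ==ᵛ (j ∷ w)) * g x) ⟩
    ∑[ i ∈ allFin n ] ∑[ u ∈ vertices k ] χ ((i ∷ u) ==ᵛ (j ∷ w)) * g (i ∷ u)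
      ≡⟨ ∑-cong (allFin n) (λ i → ∑-cong (vertices k) (λ u → factor i u)) ⟩
    ∑[ i ∈ allFin n ] ∑[ u ∈ vertices k ] χ (i ==ᶠ j) * (χ (u ==ᵛ w) * g (i ∷ u))
      ≡⟨ ∑-cong (allFin n) (λ i → ∑-*ˡ (vertices k) (χ (i ==ᶠ j)) _) ⟩
    ∑[ i ∈ allFin n ] χ (i ==ᶠ j) * (∑[ u ∈ vertices k ] χ (u ==ᵛ w) * g (i ∷ u))
      ≡⟨ ∑-cong (allFin n) (λ i → cong (χ (i ==ᶠ j) *_) (∑-δᵛ k w (g ∘ (i ∷_)))) ⟩
    ∑[ i ∈ allFin n ] χ (i ==ᶠ j) * g (i ∷ w)
      ≡⟨ ∑-δᶠ j (λ i → g (i ∷ w)) ⟩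
    g (j ∷ w) ∎
    where
    open ≡-Reasoning
    factor : ∀ i u → χ ((i ∷ u) ==ᵛ (j ∷ w)) * g (i ∷ u) ≡ χ (i ==ᶠ j) * (χ (u ==ᵛ w) * g (i ∷ u))
    factor i u = begin
      χ ((i ∷ u) ==ᵛ (j ∷ w)) * g (i ∷ u)      ≡⟨ cong (λ b → χ b * g (i ∷ u)) (==ᵛ-∷ i j u w) ⟩
      χ ((i ==ᶠ j) ∧ (u ==ᵛ w)) * g (i ∷ u)    ≡⟨ cong (_* g (i ∷ u)) (χ-∧ (i ==ᶠ j) (u ==ᵛ w)) ⟩
      χ (i ==ᶠ j) * χ (u ==ᵛ w) * g (i ∷ u)    ≡⟨ *-assoc (χ (i ==ᶠ j)) _ _ ⟩
      χ (i ==ᶠ j) * (χ (u ==ᵛ w) * g (i ∷ u))  ∎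

  ∑-δᵛ′ : (k : ℕ) (u : Vertex n k) (g : Vertex n k → ℕ) →
    ∑[ w ∈ vertices k ] χ (u ==ᵛ w) * g w ≡ g u
  ∑-δᵛ′ k u g = trans
    (∑-cong (vertices k) (λ w → cong (λ b → χ b * g w) (⌊≟⌋-sym (≡-dec _≟ᶠ_) u w)))
    (∑-δᵛ k u g)

  inDegree≡ : (k : ℕ) (y : Vertex n k) → inDegree (vertices k) (Adj k) y ≡ k * pred n
  inDegree≡ zero [] = refl
  inDegree≡ (suc k) (j ∷ w) = begin
    inDegree (vertices (suc k)) (Adj (suc k)) (j ∷ w)
      ≡⟨ ∑-vertices-suc k (λ x → χ (Adj (suc k) x (j ∷ w))) ⟩
    ∑[ i ∈ allFin n ] ∑[ u ∈ vertices k ] χ (Adj (suc k) (i ∷ u) (j ∷ w))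
      ≡⟨ ∑-cong (allFin n) (λ i → ∑-cong (vertices k) (λ u → χ-Adj-∷ i j u w)) ⟩
    ∑[ i ∈ allFin n ] ∑[ u ∈ vertices k ] (χ (u ==ᵛ w) * χ (not (i ==ᶠ j)) + χ (i ==ᶠ j) * χ (Adj k u w))
      ≡⟨ ∑-cong (allFin n) (λ i → ∑-distrib-+ (vertices k) _ _) ⟩
    ∑[ i ∈ allFin n ] ((∑[ u ∈ vertices k ] χ (u ==ᵛ w) * χ (not (i ==ᶠ j)))
                      + (∑[ u ∈ vertices k ] χ (i ==ᶠ j) * χ (Adj k u w)))
      ≡⟨ ∑-cong (allFin n) (λ i → cong₂ _+_ (∑-δᵛ k w (λ _ → χ (not (i ==ᶠ j))))
                                            (∑-*ˡ (vertices k) (χ (i ==ᶠ j)) _)) ⟩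
    ∑[ i ∈ allFin n ] (χ (not (i ==ᶠ j)) + χ (i ==ᶠ j) * inDegree (vertices k) (Adj k) w)
      ≡⟨ ∑-distrib-+ (allFin n) _ _ ⟩
    (∑[ i ∈ allFin n ] χ (not (i ==ᶠ j))) + (∑[ i ∈ allFin n ] χ (i ==ᶠ j) * inDegree (vertices k) (Adj k) w)
      ≡⟨ cong₂ _+_ (∑-χ-≢ j) (∑-δᶠ j _) ⟩
    pred n + inDegree (vertices k) (Adj k) w
      ≡⟨ cong (pred n +_) (inDegree≡ k w) ⟩
    pred n + k * pred n ∎
    where open ≡-Reasoning

  -- the cut edges of G^(suc k) changing only the head coordinate (i ≠ j is forced by S)
  headCut : (k : ℕ) → Subset n (suc k) → ℕ
  headCut k S = ∑[ i ∈ allFin n ] ∑[ j ∈ allFin n ] ∑[ u ∈ vertices k ] χ (S (i ∷ u)) * χ (not (S (j ∷ u)))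

  cut-suc : (k : ℕ) (S : Subset n (suc k)) →
    cutₖ (suc k) S ≡ headCut k S + (∑[ i ∈ allFin n ] cutₖ k (fibre S i))
  cut-suc k S = begin
    cutₖ (suc k) S
      ≡⟨ ∑∑-vertices-suc k (λ x y → χ (S x) * χ (not (S y)) * χ (Adj (suc k) x y)) ⟩
    ∑[ i ∈ allFin n ] ∑[ j ∈ allFin n ] ∑[ u ∈ vertices k ] ∑[ w ∈ vertices k ]
      χ (S (i ∷ u)) * χ (not (S (j ∷ w))) * χ (Adj (suc k) (i ∷ u) (j ∷ w))
      ≡⟨ ∑-cong (allFin n) (λ i → ∑-cong (allFin n) (λ j → split i j)) ⟩
    ∑[ i ∈ allFin n ] ∑[ j ∈ allFin n ] (H i j + χ (i ==ᶠ j) * C i j)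
      ≡⟨ ∑∑-distrib-+ (allFin n) (allFin n) H (λ i j → χ (i ==ᶠ j) * C i j) ⟩
    headCut k S + (∑[ i ∈ allFin n ] ∑[ j ∈ allFin n ] χ (i ==ᶠ j) * C i j)
      ≡⟨ cong (headCut k S +_) (∑-cong (allFin n) (λ i → ∑-δᶠ′ i (C i))) ⟩
    headCut k S + (∑[ i ∈ allFin n ] cutₖ k (fibre S i)) ∎
    where
    open ≡-Reasoning
    p : Fin n → Fin n → Vertex n k → Vertex n k → ℕ
    p i j u w = χ (S (i ∷ u)) * χ (not (S (j ∷ w)))
    H : Fin n → Fin n → ℕ
    H i j = ∑[ u ∈ vertices k ] p i j u u
    C : Fin n → Fin n → ℕ
    C i j = ∑[ u ∈ vertices k ] ∑[ w ∈ vertices k ] p i j u w * χ (Adj k u w)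
    expand : ∀ i j u w → p i j u w * χ (Adj (suc k) (i ∷ u) (j ∷ w)) ≡
             χ (u ==ᵛ w) * (p i j u w * χ (not (i ==ᶠ j))) + χ (i ==ᶠ j) * (p i j u w * χ (Adj k u w))
    expand i j u w = trans (cong (p i j u w *_) (χ-Adj-∷ i j u w))
                           (distribute (p i j u w) (χ (u ==ᵛ w)) (χ (not (i ==ᶠ j))) (χ (i ==ᶠ j)) (χ (Adj k u w)))
      where
      distribute : ∀ q a b c d → q * (a * b + c * d) ≡ a * (q * b) + c * (q * d)
      distribute = solve-∀
    split : ∀ i j → ∑[ u ∈ vertices k ] ∑[ w ∈ vertices k ] p i j u w * χ (Adj (suc k) (i ∷ u) (j ∷ w))
                    ≡ H i j + χ (i ==ᶠ j) * C i j
    split i j = begin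
      ∑[ u ∈ vertices k ] ∑[ w ∈ vertices k ] p i j u w * χ (Adj (suc k) (i ∷ u) (j ∷ w))
        ≡⟨ trans (∑-cong (vertices k) (λ u → ∑-cong (vertices k) (expand i j u)))
                 (∑∑-distrib-+ (vertices k) (vertices k) _ _) ⟩
      (∑[ u ∈ vertices k ] ∑[ w ∈ vertices k ] χ (u ==ᵛ w) * (p i j u w * χ (not (i ==ᶠ j))))
      + (∑[ u ∈ vertices k ] ∑[ w ∈ vertices k ] χ (i ==ᶠ j) * (p i j u w * χ (Adj k u w)))
        ≡⟨ cong₂ _+_ (∑-cong (vertices k) (λ u → ∑-δᵛ′ k u (λ w → p i j u w * χ (not (i ==ᶠ j)))))
                     (trans (∑-cong (vertices k) (λ u → ∑-*ˡ (vertices k) (χ (i ==ᶠ j)) _))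
                            (∑-*ˡ (vertices k) (χ (i ==ᶠ j)) _)) ⟩
      (∑[ u ∈ vertices k ] p i j u u * χ (not (i ==ᶠ j))) + χ (i ==ᶠ j) * C i j
        ≡⟨ cong (_+ χ (i ==ᶠ j) * C i j)
             (∑-cong (vertices k) (λ u → χ-not-⌊≟⌋-redundant _≟ᶠ_ (λ i → S (i ∷ u)) i j)) ⟩
      H i j + χ (i ==ᶠ j) * C i j ∎

  pairs-suc≤ : (k : ℕ) (S : Subset n (suc k)) →
    pairs (vertices (suc k)) S ≤ n ^ k * headCut k S + n * (∑[ j ∈ allFin n ] pairs (vertices k) (fibre S j))
  pairs-suc≤ k S = begin
    pairs (vertices (suc k)) S
      ≡⟨ ∑∑-vertices-suc k (λ x y → χ (S x) * χ (not (S y))) ⟩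
    ∑[ i ∈ allFin n ] ∑[ j ∈ allFin n ] ∑[ u ∈ vertices k ] ∑[ w ∈ vertices k ] χ (S (i ∷ u)) * χ (not (S (j ∷ w)))
      ≤⟨ ∑-mono-≤ (allFin n) (λ i → ∑-mono-≤ (allFin n) (λ j → route i j)) ⟩
    ∑[ i ∈ allFin n ] ∑[ j ∈ allFin n ] (n ^ k * H i j + P j)
      ≡⟨ ∑∑-distrib-+ (allFin n) (allFin n) (λ i j → n ^ k * H i j) (λ _ → P) ⟩
    (∑[ i ∈ allFin n ] ∑[ j ∈ allFin n ] n ^ k * H i j) + (∑[ i ∈ allFin n ] ∑[ j ∈ allFin n ] P j)
      ≡⟨ cong₂ _+_ (trans (∑-cong (allFin n) (λ i → ∑-*ˡ (allFin n) (n ^ k) (H i))) (∑-*ˡ (allFin n) (n ^ k) _))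
                   (∑-allFin-const n _) ⟩
    n ^ k * headCut k S + n * (∑[ j ∈ allFin n ] P j) ∎
    where
    open ≤-Reasoning
    H : Fin n → Fin n → ℕ
    H i j = ∑[ u ∈ vertices k ] χ (S (i ∷ u)) * χ (not (S (j ∷ u)))
    P : Fin n → ℕ
    P j = pairs (vertices k) (fibre S j)
    -- a pair (i ∷ u ∈ S, j ∷ w ∉ S) is routed through j ∷ u
    route : ∀ i j → ∑[ u ∈ vertices k ] ∑[ w ∈ vertices k ] χ (S (i ∷ u)) * χ (not (S (j ∷ w)))
                    ≤ n ^ k * H i j + P j
    route i j = begin
      ∑[ u ∈ vertices k ] ∑[ w ∈ vertices k ] χ (S (i ∷ u)) * χ (not (S (j ∷ w)))
        ≤⟨ ∑-mono-≤ (vertices k) (λ u → ∑-mono-≤ (vertices k) (λ w →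
             χ-not-triangle (S (i ∷ u)) (S (j ∷ u)) (S (j ∷ w)))) ⟩
      ∑[ u ∈ vertices k ] ∑[ w ∈ vertices k ] (χ (S (i ∷ u)) * χ (not (S (j ∷ u))) + χ (S (j ∷ u)) * χ (not (S (j ∷ w))))
        ≡⟨ ∑∑-distrib-+ (vertices k) (vertices k) _ _ ⟩
      (∑[ u ∈ vertices k ] ∑[ w ∈ vertices k ] χ (S (i ∷ u)) * χ (not (S (j ∷ u)))) + P j
        ≡⟨ cong (_+ P j) (trans (∑-cong (vertices k) (λ u → ∑-vertices-const k _)) (∑-*ˡ (vertices k) (n ^ k) _)) ⟩
      n ^ k * H i j + P j ∎

  poincaré : (k : ℕ) (S : Subset n k) → n * pairs (vertices k) S ≤ n ^ k * cutₖ k S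
  poincaré zero S = ≤-trans (≤-reflexive (trans (cong (λ p → n * (p + 0 + 0)) (χ*χ-not (S []))) (*-zeroʳ n))) z≤n
  poincaré (suc k) S = begin
    n * pairs (vertices (suc k)) S
      ≤⟨ *-monoʳ-≤ n (pairs-suc≤ k S) ⟩
    n * (n ^ k * headCut k S + n * (∑[ j ∈ allFin n ] P j))
      ≡⟨ *-distribˡ-+ n _ _ ⟩
    n * (n ^ k * headCut k S) + n * (n * (∑[ j ∈ allFin n ] P j))
      ≡⟨ cong₂ _+_ (*-assoc n (n ^ k) _) (cong (n *_) (∑-*ˡ (allFin n) n P)) ⟨
    n ^ suc k * headCut k S + n * (∑[ j ∈ allFin n ] n * P j)
      ≤⟨ +-monoʳ-≤ _ (*-monoʳ-≤ n (∑-mono-≤ (allFin n) (λ j → poincaré k (fibre S j)))) ⟩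
    n ^ suc k * headCut k S + n * (∑[ j ∈ allFin n ] n ^ k * cutₖ k (fibre S j))
      ≡⟨ cong (λ z → n ^ suc k * headCut k S + n * z) (∑-*ˡ (allFin n) (n ^ k) _) ⟩
    n ^ suc k * headCut k S + n * (n ^ k * (∑[ j ∈ allFin n ] cutₖ k (fibre S j)))
      ≡⟨ cong (n ^ suc k * headCut k S +_) (*-assoc n (n ^ k) _) ⟨
    n ^ suc k * headCut k S + n ^ suc k * (∑[ j ∈ allFin n ] cutₖ k (fibre S j))
      ≡⟨ *-distribˡ-+ (n ^ suc k) _ _ ⟨
    n ^ suc k * (headCut k S + (∑[ j ∈ allFin n ] cutₖ k (fibre S j)))
      ≡⟨ cong (n ^ suc k *_) (cut-suc k S) ⟨
    n ^ suc k * cutₖ (suc k) S ∎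
    where
    open ≤-Reasoning
    P : Fin n → ℕ
    P j = pairs (vertices k) (fibre S j)

  pairs≡card*card : (k : ℕ) (S : Subset n k) → pairs (vertices k) S ≡ card n k S * card n k (not ∘ S)
  pairs≡card*card k S = sym (trans
    (cong₂ _*_ (count≡∑χ S (vertices k)) (count≡∑χ (not ∘ S) (vertices k)))
    (∑-*-∑ (vertices k) (vertices k) (χ ∘ S) (χ ∘ not ∘ S)))

  card+card-not : (k : ℕ) (S : Subset n k) → card n k S + card n k (not ∘ S) ≡ n ^ k
  card+card-not k S = begin
    card n k S + card n k (not ∘ S)
      ≡⟨ cong₂ _+_ (count≡∑χ S (vertices k)) (count≡∑χ (not ∘ S) (vertices k)) ⟩
    (∑[ x ∈ vertices k ] χ (S x)) + (∑[ x ∈ vertices k ] χ (not (S x)))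
      ≡⟨ ∑-distrib-+ (vertices k) _ _ ⟨
    ∑[ x ∈ vertices k ] (χ (S x) + χ (not (S x)))
      ≡⟨ ∑-cong (vertices k) (χ+χ-not ∘ S) ⟩
    ∑[ x ∈ vertices k ] 1
      ≡⟨ trans (∑-vertices-const k 1) (*-identityʳ (n ^ k)) ⟩
    n ^ k ∎
    where open ≡-Reasoning

corollary5p2 : (n k : ℕ) → 1 ≤ k → (S : Subset n k) →
    0 < card n k S → 2 * card n k S ≤ n ^ k →
    card n k S < (2 * k) * boundary n k S
corollary5p2 n zero () S
corollary5p2 zero (suc k) _ S () _
corollary5p2 (suc m) k@(suc _) _ S card>0 half =
  expansion-bound {m = m} {k = k} {B = boundary (suc m) k S} card>0 (card+card-not k S) half
    (subst (λ p → suc m * p ≤ suc m ^ k * cutₖ k S) (pairs≡card*card k S) (poincaré k S))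
    (cut≤*boundary (vertices k) (Adj k) S (k * m) (λ y → ≤-reflexive (inDegree≡ k y)))
  where open Hamming (suc m)
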